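{- Let $G$ be a finite forest and let $F$ be an even graph that is a subgraph of $G$. Then $$|\mathrm{Sub}_F(G)|\equiv|\mathrm{Sub}_F(G_{\mathrm{rc}})|\pmod 2.$$
   Context: All graphs are undirected. An automorphism $\sigma$ of a graph is odd if, for some (equivalently any) orientation of its edges, an odd number of edges have their orientation reversed by $\sigma$; a graph is odd if it has an odd automorphism and even otherwise. An edge of a tree is a mirror-bridge if some automorphism of the tree swaps its endpoints; an odd tree has a unique mirror-bridge. Recursive cutting: for a forest $G$, set $G_0=G$ and obtain $G_{i+1}$ from $G_i$ by removing the mirror-bridge of each odd component of $G_i$ (keeping all vertices); $G_{\mathrm{rc}}$ is the even forest at which this sequence stabilizes. $\mathrm{Sub}_F(G)=\{F'\subseteq G: F'\cong F\}$, where $F'\subseteq G$ means $V(F')\subseteq V(G)$ and $E(F')\subseteq E(G)$. -}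

module Defs where

open import Level using (Level; _⊔_)
open import Data.Nat using (ℕ; zero; suc; _+_; _≤_; _%_)
open import Data.Fin using (Fin; zero; suc; inject₁; fromℕ)
open import Data.Bool using (Bool; true; false; T)
open import Data.List using (List; []; _∷_; map; concatMap; allFin; cartesianProduct)
open import Data.Product using (Σ; ∃; _×_; _,_)
open import Data.Sum using (_⊎_)
open import Relation.Nullary using (¬_)
open import Relation.Binary.PropositionalEquality using (_≡_)
open import Relation.Binary.Construct.Closure.ReflexiveTransitive using (Star)
open import Function.Definitions using (Injective)
open import Function.Bundles using (_⇔_)

-- Finite graphs whose vertex set is a subset of Fin n.
-- V i : "i is a vertex";  E i j : "{i,j} is an edge".

record Graph (n : ℕ) : Set₁ where
  field
    V : Fin n → Set
    E : Fin n → Fin n → Set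
open Graph public

record WellFormed {n : ℕ} (G : Graph n) : Set where
  field
    E-sym : ∀ i j → E G i j → E G j i
    E-irr : ∀ i → ¬ E G i i
    E-V   : ∀ i j → E G i j → V G i

_⊆G_ : ∀ {n} → Graph n → Graph n → Set
H ⊆G G = (∀ i → V H i → V G i) × (∀ i j → E H i j → E G i j)

_≈G_ : ∀ {n} → Graph n → Graph n → Set
H ≈G G = (∀ i → V H i ⇔ V G i) × (∀ i j → E H i j ⇔ E G i j)

record Iso {n m : ℕ} (G : Graph n) (H : Graph m) : Set where
  field
    φ : Fin n → Fin m
    ψ : Fin m → Fin n
    φ-V : ∀ i → V G i → V H (φ i)
    ψ-V : ∀ a → V H a → V G (ψ a)
    ψφ  : ∀ i → V G i → ψ (φ i) ≡ i
    φψ  : ∀ a → V H a → φ (ψ a) ≡ a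
    φ-E : ∀ i j → V G i → V G j → (E G i j ⇔ E H (φ i) (φ j))
open Iso public

Aut : ∀ {n} → Graph n → Set
Aut G = Iso G G

data Count {a ℓ : Level} {A : Set a} (P : A → Set ℓ) : List A → ℕ → Set (a ⊔ ℓ) where
  []  : Count P [] 0
  yes : ∀ {x xs k} → P x → Count P xs k → Count P (x ∷ xs) (suc k)
  no  : ∀ {x xs k} → ¬ P x → Count P xs k → Count P (x ∷ xs) k

allPairs : ∀ n → List (Fin n × Fin n)
allPairs n = cartesianProduct (allFin n) (allFin n)

record Orientation {n : ℕ} (G : Graph n) : Set₁ where
  field
    O      : Fin n → Fin n → Set
    O-E    : ∀ i j → O i j → E G i j
    O-tot  : ∀ i j → E G i j → O i j ⊎ O j i
    O-anti : ∀ i j → O i j → ¬ O j i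
open Orientation public

Reversed : ∀ {n} {G : Graph n} → Aut G → Orientation G → Fin n × Fin n → Set
Reversed σ o (i , j) = O o i j × O o (φ σ j) (φ σ i)

OddAut : ∀ {n} (G : Graph n) → Aut G → Set₁
OddAut {n} G σ = Σ (Orientation G) λ o → Σ ℕ λ k →
  Count (Reversed σ o) (allPairs n) k × k % 2 ≡ 1

OddGraph : ∀ {n} → Graph n → Set₁
OddGraph G = Σ (Aut G) λ σ → OddAut G σ

EvenGraph : ∀ {n} → Graph n → Set₁
EvenGraph G = ¬ OddGraph G

record Cycle {n : ℕ} (G : Graph n) : Set where
  field
    len  : ℕ
    c    : Fin (suc (suc (suc len))) → Fin n
    inj  : Injective _≡_ _≡_ c
    step : ∀ (i : Fin (suc (suc len))) → E G (c (inject₁ i)) (c (suc i))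
    close : E G (c (fromℕ (suc (suc len)))) (c zero)

Forest : ∀ {n} → Graph n → Set
Forest G = WellFormed G × ¬ Cycle G

component : ∀ {n} → Graph n → Fin n → Graph n
V (component G v) i   = V G v × Star (E G) v i
E (component G v) i j = E G i j × Star (E G) v i

MirrorBridge : ∀ {n} → Graph n → Fin n → Fin n → Set
MirrorBridge T u v = E T u v × Σ (Aut T) λ σ → (φ σ u ≡ v) × (φ σ v ≡ u)

-- one step of recursive cutting: H is obtained from G by removing the
-- mirror-bridge of each odd component of G (keeping all vertices).
-- (An odd tree has a unique mirror-bridge, so "the mirror-bridge of the odd
-- component containing i" is an edge {i,j} that is a mirror-bridge of it.)
CutStep : ∀ {n} → Graph n → Graph n → Set₁
CutStep G H =
  (∀ i → V H i ⇔ V G i) ×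
  (∀ i j → E H i j ⇔ (E G i j × ¬ (OddGraph (component G i) × MirrorBridge (component G i) i j)))

RecCut : ∀ {n} → Graph n → Graph n → Set₁
RecCut {n} G H = Σ (ℕ → Graph n) λ seq →
  (seq 0 ≈G G) × (∀ i → CutStep (seq i) (seq (suc i))) ×
  Σ ℕ λ k → ∀ i → k ≤ i → seq i ≈G H

-- Sub_F(G): enumerate every candidate (V', E') as Boolean functions

funs : ∀ {a} {A : Set a} → (n : ℕ) → List A → List (Fin n → A)
funs zero    xs = (λ ()) ∷ []
funs (suc n) xs = concatMap (λ f → map (λ x → cons x f) xs) (funs n xs)
  where
  cons : _ → (Fin _ → _) → Fin (suc _) → _
  cons x f zero    = x
  cons x f (suc i) = f i

bools : List Bool
bools = true ∷ false ∷ []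

Candidate : ℕ → Set
Candidate n = (Fin n → Bool) × (Fin n → Fin n → Bool)

candidates : ∀ n → List (Candidate n)
candidates n = cartesianProduct (funs n bools) (funs n (funs n bools))

toGraph : ∀ {n} → Candidate n → Graph n
V (toGraph (vb , eb)) i   = T (vb i)
E (toGraph (vb , eb)) i j = T (eb i j)

InSub : ∀ {n} → Graph n → Graph n → Candidate n → Set
InSub F G c = WellFormed (toGraph c) × (toGraph c ⊆G G) × Iso (toGraph c) F

SubCount : ∀ {n} → Graph n → Graph n → ℕ → Set
SubCount {n} F G k = Count (InSub F G) (candidates n) k

module Submission where

-- One step of recursive cutting removes the mirror-bridges of the odd
-- components, and it suffices to show that removing one mirror-bridge uv
-- preserves |Sub_F| mod 2.  Let σ be an automorphism of the tree containing
-- uv that swaps u and v, and ι the involution that acts as σ on the side of u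
-- and as σ⁻¹ on the side of v.  The copies of F avoiding uv are the copies
-- after the removal; the copies using uv are permuted by ι, and a copy fixed
-- by ι would carry an automorphism of F reversing exactly one edge, making F
-- odd.  So the copies using uv come in pairs.
--
-- Vertex and edge predicates are not
-- decidable, so case distinctions on them are made under double negation,
-- which suffices because the conclusion is a decidable equation.

open import Level using (0ℓ)
open import Data.Nat using (ℕ; zero; suc; _+_; _*_; _≤_; _<_; _%_; s≤s)
open import Data.Nat.Properties using (≤-refl; ≤-trans; n≤1+n; +-suc; +-comm)
open import Data.Nat.Divisibility using (_∣_; divides)
open import Data.Nat.DivMod using ([m+kn]%n≡m%n)
open import Data.Fin using (Fin; zero; suc)
open import Data.Bool using (T)
open import Data.List using (List; []; _∷_; length; map; concatMap; cartesianProductWith)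
open import Data.List.Properties using (length-removeAt′)
open import Data.List.Relation.Unary.Any as Any using (Any; here; there)
open import Data.List.Relation.Unary.All using (All; []; _∷_)
open import Data.List.Relation.Unary.AllPairs using ([]; _∷_)
open import Data.Product using (Σ; _×_; _,_; proj₁; proj₂; uncurry)
open import Data.Sum using (_⊎_; inj₁; inj₂)
import Data.Sum as Sum
open import Data.Empty using (⊥; ⊥-elim)
open import Relation.Nullary using (¬_; Dec; ¬¬-excluded-middle; decidable-stable) renaming (yes to yes′; no to no′)
open import Function using (_∘_)
open import Function.Bundles using (mk⇔; Equivalence)
open import Relation.Binary.Bundles using (Setoid)
open import Relation.Binary.PropositionalEquality using (_≡_; _≢_; refl; sym; trans; cong; subst)
open import Relation.Binary.Construct.Closure.ReflexiveTransitive using (Star; ε; _◅_; _◅◅_)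
open import Defs

open Equivalence using (to; from)

infixl 1 _>>=_
_>>=_ : ∀ {a b} {A : Set a} {B : Set b} → ¬ ¬ A → (A → ¬ ¬ B) → ¬ ¬ B
(m >>= f) ¬b = m λ a → f a ¬b

return : ∀ {a} {A : Set a} → A → ¬ ¬ A
return a ¬a = ¬a a

¬¬-Π-Fin : ∀ {ℓ} m {P : Fin m → Set ℓ} → (∀ i → ¬ ¬ P i) → ¬ ¬ (∀ i → P i)
¬¬-Π-Fin zero    f k = k λ ()
¬¬-Π-Fin (suc m) f k = f zero λ p₀ → ¬¬-Π-Fin m (λ i → f (suc i)) λ ps →
  k λ { zero → p₀ ; (suc i) → ps i }

module _ {A : Set} where

  count-unique : ∀ {P : A → Set} {xs k k′} → Count P xs k → Count P xs k′ → k ≡ k′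
  count-unique []        []         = refl
  count-unique (yes p c) (yes _ c′) = cong suc (count-unique c c′)
  count-unique (yes p c) (no ¬p c′) = ⊥-elim (¬p p)
  count-unique (no ¬p c) (yes p c′) = ⊥-elim (¬p p)
  count-unique (no _ c)  (no _ c′)  = count-unique c c′

  count-resp : ∀ {P Q : A → Set} {xs k} → (∀ x → P x → Q x) → (∀ x → Q x → P x) →
               Count P xs k → Count Q xs k
  count-resp f g []        = []
  count-resp f g (yes p c) = yes (f _ p) (count-resp f g c)
  count-resp f g (no ¬p c) = no (λ q → ¬p (g _ q)) (count-resp f g c)

  count-exists : ∀ {P : A → Set} xs → ¬ ¬ Σ ℕ (Count P xs)
  count-exists []       k = k (0 , [])
  count-exists (x ∷ xs) k = count-exists xs λ (j , c) →
    k (j , no (λ p → k (suc j , yes p c)) c)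

  count-split : ∀ {P Q : A → Set} {xs k} → Count P xs k → (∀ x → Dec (Q x)) →
    Σ ℕ λ a → Σ ℕ λ b →
      Count (λ x → P x × Q x) xs a × Count (λ x → P x × ¬ Q x) xs b × k ≡ a + b
  count-split [] Q? = 0 , 0 , [] , [] , refl
  count-split (yes {x} p c) Q? with count-split c Q? | Q? x
  ... | a , b , ca , cb , refl | yes′ q =
    suc a , b , yes (p , q) ca , no (λ z → proj₂ z q) cb , refl
  ... | a , b , ca , cb , refl | no′ ¬q =
    a , suc b , no (λ z → ¬q (proj₂ z)) ca , yes (p , ¬q) cb , sym (+-suc a b)
  count-split (no ¬p c) Q? with count-split c Q?
  ... | a , b , ca , cb , e = a , b , no (¬p ∘ proj₁) ca , no (¬p ∘ proj₁) cb , e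

module _ {A : Set} where
  open import Data.List.Relation.Unary.Unique.Propositional using (Unique)
  open import Data.List.Membership.Propositional using (_∈_)
  open import Relation.Binary.Definitions using (DecidableEquality)

  count-single : ∀ {P : A → Set} {p₀ : A} → DecidableEquality A →
                 (∀ x → P x → x ≡ p₀) → P p₀ → ∀ {xs} → Unique xs → p₀ ∈ xs → Count P xs 1
  count-single {P} {p₀} _≟_ only P₀ = go
    where
    none : ∀ {xs} → All (p₀ ≢_) xs → Count P xs 0
    none []         = []
    none (ne ∷ nes) = no (λ px → ne (sym (only _ px))) (none nes)
    go : ∀ {xs} → Unique xs → p₀ ∈ xs → Count P xs 1
    go (p₀∉ ∷ _) (here refl) = yes P₀ (none p₀∉)
    go {x ∷ _} (p₀∉ ∷ u) (there m) with x ≟ p₀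
    ... | yes′ refl = yes P₀ (none p₀∉)
    ... | no′ x≢p₀  = no (x≢p₀ ∘ only x) (go u m)

-- The proof repeatedly removes a Q-element together with its
-- ι-partner.

module InvolutionParity (S : Setoid 0ℓ 0ℓ) where
  open Setoid S renaming (Carrier to A; refl to ≈-refl; sym to ≈-sym; trans to ≈-trans)
  open import Data.List.Membership.Setoid S using (_∈_; _∉_; _─_)
  open import Data.List.Membership.Setoid.Properties using (∈-resp-≈)
  open import Data.List.Relation.Unary.Unique.Setoid S using (Unique)
  open import Data.List.Relation.Unary.All.Properties using (─⁺; All¬⇒¬Any)

  module _ {x : A} where

    ∈-─⁻ : ∀ {w xs} (p : x ∈ xs) → w ∈ xs ─ p → w ∈ xs
    ∈-─⁻ (here _)  m         = there m
    ∈-─⁻ (there p) (here e)  = here e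
    ∈-─⁻ (there p) (there m) = there (∈-─⁻ p m)

    ∈-─⁺ : ∀ {w xs} (p : x ∈ xs) → w ∈ xs → ¬ w ≈ x → w ∈ xs ─ p
    ∈-─⁺ (here e)  (here e′) w≉x = ⊥-elim (w≉x (≈-trans e′ (≈-sym e)))
    ∈-─⁺ (here _)  (there m) w≉x = m
    ∈-─⁺ (there p) (here e′) w≉x = here e′
    ∈-─⁺ (there p) (there m) w≉x = there (∈-─⁺ p m w≉x)

    ∉-─ : ∀ {xs} (p : x ∈ xs) → Unique xs → x ∉ xs ─ p
    ∉-─ (here e)  (y≉ ∷ _) m         = All¬⇒¬Any y≉ (Any.map (≈-trans (≈-sym e)) m)
    ∉-─ (there p) (y≉ ∷ _) (here e)  = All¬⇒¬Any y≉ (Any.map (≈-trans (≈-sym e)) p)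
    ∉-─ (there p) (_ ∷ u)  (there m) = ∉-─ p u m

    unique-─ : ∀ {xs} (p : x ∈ xs) → Unique xs → Unique (xs ─ p)
    unique-─ (here _)  (_ ∷ u)  = u
    unique-─ (there p) (y≉ ∷ u) = ─⁺ p y≉ ∷ unique-─ p u

    count-─ : ∀ {Q : A → Set} → (∀ {a b} → a ≈ b → Q a → Q b) → Q x →
              ∀ {xs j} (p : x ∈ xs) → Count Q xs j → Σ ℕ λ j′ → j ≡ suc j′ × Count Q (xs ─ p) j′
    count-─ Q-resp qx (here e)  (yes _ c)  = _ , refl , c
    count-─ Q-resp qx (here e)  (no ¬q c)  = ⊥-elim (¬q (Q-resp e qx))
    count-─ Q-resp qx (there p) (yes q c) with count-─ Q-resp qx p c
    ... | j′ , refl , c′ = suc j′ , refl , yes q c′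
    count-─ Q-resp qx (there p) (no ¬q c) with count-─ Q-resp qx p c
    ... | j′ , refl , c′ = j′ , refl , no ¬q c′

  module _ (Q : A → Set) (Q-resp : ∀ {a b} → a ≈ b → Q a → Q b)
           (ι : A → A) (ι-cong : ∀ {a b} → a ≈ b → ι a ≈ ι b) (ι-invol : ∀ a → ι (ι a) ≈ a)
           (Q-ι : ∀ a → Q a → Q (ι a)) (ι-no-fix : ∀ a → Q a → ¬ ι a ≈ a) where

    Closed : List A → Set
    Closed xs = ∀ w → w ∈ xs → Q w → ι w ∈ xs

    private
      -- bounded by the length of the list, to make the recursion structural
      even-within : ∀ m xs {k} → length xs ≤ m → Unique xs → Closed xs → Count Q xs k → 2 ∣ k
      even-within m [] _ _ _ [] = divides 0 refl
      -- x is not a Q-element: xs is still closed, as x is no Q-element's partner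
      even-within (suc m) (x ∷ xs) (s≤s len) (x∉ ∷ u) cl (no ¬q c) =
        even-within m xs len u cl′ c
        where
        cl′ : Closed xs
        cl′ w w∈ q with cl w (there w∈) q
        ... | here e   = ⊥-elim (¬q (Q-resp e (Q-ι w q)))
        ... | there ιw∈ = ιw∈
      even-within (suc m) (x ∷ xs) (s≤s len) (x∉ ∷ u) cl (yes q c)
        with cl x (here ≈-refl) q
      ... | here e = ⊥-elim (ι-no-fix x q e)
      ... | there p with count-─ Q-resp (Q-ι x q) p c
      ... | j , refl , c′ with even-within m (xs ─ p) len′ (unique-─ p u) cl′ c′
        where
        len′ : length (xs ─ p) ≤ m
        len′ = ≤-trans (n≤1+n _) (subst (_≤ m) (length-removeAt′ xs (Any.index p)) len)
        -- the partner of a remaining element is neither x nor ι x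
        cl′ : Closed (xs ─ p)
        cl′ w w∈ qw with cl w (there (∈-─⁻ p w∈)) qw
        ... | here e = ⊥-elim (∉-─ p u (∈-resp-≈ S (≈-trans (≈-sym (ι-invol w)) (ι-cong e)) w∈))
        ... | there ιw∈ = ∈-─⁺ p ιw∈ λ e →
          All¬⇒¬Any x∉ (∈-resp-≈ S (≈-trans (≈-sym (ι-invol w)) (≈-trans (ι-cong e) (ι-invol x)))
                                  (∈-─⁻ p w∈))
      ... | divides h refl = divides (suc h) refl

    even-count : ∀ xs {k} → Unique xs → Closed xs → Count Q xs k → 2 ∣ k
    even-count xs = even-within (length xs) xs ≤-refl

module Enumeration where
  open import Data.Bool using (Bool; true; false)
  open import Data.List using (_++_)
  open import Data.Vec.Functional using (Vector)
  open import Data.Product.Relation.Binary.Pointwise.NonDependent using (_×ₛ_)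
  open import Relation.Binary.PropositionalEquality using (subst₂)
  import Relation.Binary.PropositionalEquality as ≡
  import Data.Vec.Functional.Relation.Binary.Equality.Setoid as VecEq
  import Data.List.Membership.Setoid as Mem
  import Data.List.Membership.Setoid.Properties as MemP
  import Data.List.Relation.Unary.Unique.Setoid as Uniq
  import Data.List.Relation.Unary.Unique.Setoid.Properties as UniqP

  concatMap-map : ∀ {A B C : Set} (g : A → B → C) xs ys →
                  concatMap (λ a → map (g a) ys) xs ≡ cartesianProductWith g xs ys
  concatMap-map g []       ys = refl
  concatMap-map g (x ∷ xs) ys = cong (map (g x) ys ++_) (concatMap-map g xs ys)

  module Vectors (S : Setoid 0ℓ 0ℓ) where
    open Setoid S using (_≈_; reflexive) renaming (Carrier to A)
    open VecEq S using (≋-setoid)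
    open Mem S using (_∈_)
    open Uniq S using (Unique)

    _∈ᵥ_ : ∀ {n} → Vector A n → List (Vector A n) → Set
    _∈ᵥ_ {n} = Mem._∈_ (≋-setoid n)

    Uniqueᵥ : ∀ {n} → List (Vector A n) → Set
    Uniqueᵥ {n} = Uniq.Unique (≋-setoid n)

    -- The prepending operation is local to Defs, so it is abstracted as h,
    -- whose computation rules then hold by refl.
    module Extend {n} (h : A → Vector A n → Vector A (suc n))
      (h-head : ∀ x f → h x f zero ≡ x) (h-tail : ∀ x f i → h x f (suc i) ≡ f i)
      (xs : List A) (fs : List (Vector A n)) where

      h-≋ : ∀ {x x′ f f′} → x ≈ x′ → (∀ i → f i ≈ f′ i) → ∀ i → h x f i ≈ h x′ f′ i
      h-≋ x≈ f≋ zero    = subst₂ _≈_ (sym (h-head _ _)) (sym (h-head _ _)) x≈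
      h-≋ x≈ f≋ (suc i) = subst₂ _≈_ (sym (h-tail _ _ i)) (sym (h-tail _ _ i)) (f≋ i)

      h-≋⁻ : ∀ {x x′ f f′} → (∀ i → h x f i ≈ h x′ f′ i) → (∀ i → f i ≈ f′ i) × x ≈ x′
      h-≋⁻ e = (λ i → subst₂ _≈_ (h-tail _ _ i) (h-tail _ _ i) (e (suc i))) ,
               subst₂ _≈_ (h-head _ _) (h-head _ _) (e zero)

      extension≡product : concatMap (λ f → map (λ x → h x f) xs) fs ≡
                          cartesianProductWith (λ f x → h x f) fs xs
      extension≡product = concatMap-map (λ f x → h x f) fs xs

      complete : (∀ x → x ∈ xs) → (∀ f → f ∈ᵥ fs) →
                 ∀ g → g ∈ᵥ concatMap (λ f → map (λ x → h x f) xs) fs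
      complete all-xs all-fs g = subst (g ∈ᵥ_) (sym extension≡product)
        (MemP.∈-resp-≈ (≋-setoid (suc n)) h≋g
          (MemP.∈-cartesianProductWith⁺ (≋-setoid n) S (≋-setoid (suc n))
            (λ f≋ x≈ → h-≋ x≈ f≋) (all-fs (g ∘ suc)) (all-xs (g zero))))
        where
        h≋g : ∀ i → h (g zero) (g ∘ suc) i ≈ g i
        h≋g zero    = reflexive (h-head _ _)
        h≋g (suc i) = reflexive (h-tail _ _ i)

      unique : Unique xs → Uniqueᵥ fs → Uniqueᵥ (concatMap (λ f → map (λ x → h x f) xs) fs)
      unique u-xs u-fs = subst Uniqueᵥ (sym extension≡product)
        (UniqP.cartesianProductWith⁺ (≋-setoid n) S (≋-setoid (suc n)) _ h-≋⁻ u-fs u-xs)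

    funs-complete : ∀ n xs → (∀ x → x ∈ xs) → ∀ g → g ∈ᵥ funs n xs
    funs-complete zero    xs all-xs g = here λ ()
    funs-complete (suc n) xs all-xs =
      Extend.complete _ (λ _ _ → refl) (λ _ _ _ → refl) xs (funs n xs) all-xs (funs-complete n xs all-xs)

    funs-unique : ∀ n xs → Unique xs → Uniqueᵥ (funs n xs)
    funs-unique zero    xs u = [] ∷ []
    funs-unique (suc n) xs u =
      Extend.unique _ (λ _ _ → refl) (λ _ _ _ → refl) xs (funs n xs) u (funs-unique n xs u)

  BoolS : Setoid 0ℓ 0ℓ
  BoolS = ≡.setoid Bool

  RowS MatrixS CandidateS : ℕ → Setoid 0ℓ 0ℓ
  RowS n = VecEq.≋-setoid BoolS n
  MatrixS n = VecEq.≋-setoid (RowS n) n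
  CandidateS n = RowS n ×ₛ MatrixS n

  bools-complete : ∀ b → Mem._∈_ BoolS b bools
  bools-complete true  = here refl
  bools-complete false = there (here refl)

  bools-unique : Uniq.Unique BoolS bools
  bools-unique = ((λ ()) ∷ []) ∷ [] ∷ []

  module Rows = Vectors BoolS
  module Matrices {n} = Vectors (RowS n)

  candidates-complete : ∀ n c → Mem._∈_ (CandidateS n) c (candidates n)
  candidates-complete n (vb , eb) = MemP.∈-cartesianProduct⁺ (RowS n) (MatrixS n)
    (Rows.funs-complete n bools bools-complete vb)
    (Matrices.funs-complete {n} n (funs n bools) (Rows.funs-complete n bools bools-complete) eb)

  candidates-unique : ∀ n → Uniq.Unique (CandidateS n) (candidates n)
  candidates-unique n = UniqP.cartesianProduct⁺ (RowS n) (MatrixS n)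
    (Rows.funs-unique n bools bools-unique)
    (Matrices.funs-unique {n} n (funs n bools) (Rows.funs-unique n bools bools-unique))

module _ {n : ℕ} where

  ≈G-sym : {A B : Graph n} → A ≈G B → B ≈G A
  ≈G-sym (v , e) = (λ i → mk⇔ (from (v i)) (to (v i))) , (λ i j → mk⇔ (from (e i j)) (to (e i j)))

  wf-≈ : {A B : Graph n} → A ≈G B → WellFormed A → WellFormed B
  wf-≈ (v , e) w = record
    { E-sym = λ i j x → to (e j i) (E-sym i j (from (e i j) x))
    ; E-irr = λ i x → E-irr i (from (e i i) x)
    ; E-V   = λ i j x → to (v i) (E-V i j (from (e i j) x)) }
    where open WellFormed w

  acyclic-⊆ : {A B : Graph n} → (∀ i j → E A i j → E B i j) → ¬ Cycle B → ¬ Cycle A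
  acyclic-⊆ f no-cycle cy = no-cycle record
    { len = len ; c = c ; inj = inj ; step = λ i → f _ _ (step i) ; close = f _ _ close }
    where open Cycle cy

  forest-≈ : {A B : Graph n} → A ≈G B → Forest A → Forest B
  forest-≈ h (w , acyc) = wf-≈ h w , acyclic-⊆ (λ i j → from (proj₂ h i j)) acyc

  ≈G⇒Iso : {A B : Graph n} → A ≈G B → Iso A B
  ≈G⇒Iso (v , e) = record
    { φ = λ i → i ; ψ = λ i → i ; φ-V = λ i → to (v i) ; ψ-V = λ i → from (v i)
    ; ψφ = λ _ _ → refl ; φψ = λ _ _ → refl ; φ-E = λ i j _ _ → e i j }

iso-∘ : ∀ {n m k} {A : Graph n} {B : Graph m} {C : Graph k} → Iso A B → Iso B C → Iso A C
iso-∘ s t = record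
  { φ   = λ i → φ t (φ s i)
  ; ψ   = λ a → ψ s (ψ t a)
  ; φ-V = λ i x → φ-V t _ (φ-V s i x)
  ; ψ-V = λ a x → ψ-V s _ (ψ-V t a x)
  ; ψφ  = λ i x → trans (cong (ψ s) (ψφ t _ (φ-V s i x))) (ψφ s i x)
  ; φψ  = λ a x → trans (cong (φ t) (φψ s _ (ψ-V t a x))) (φψ t a x)
  ; φ-E = λ i j vi vj →
      let e₁ = φ-E s i j vi vj ; e₂ = φ-E t _ _ (φ-V s i vi) (φ-V s j vj) in
      mk⇔ (to e₂ ∘ to e₁) (from e₁ ∘ from e₂) }

module _ {n : ℕ} where

  -- an automorphism of A, viewed as one of B; its vertex map is unchanged
  aut-≈ : {A B : Graph n} → A ≈G B → Aut A → Aut B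
  aut-≈ h σ = iso-∘ (≈G⇒Iso (≈G-sym h)) (iso-∘ σ (≈G⇒Iso h))

  odd-≈ : {A B : Graph n} → A ≈G B → OddGraph A → OddGraph B
  odd-≈ {A} {B} h (σ , o , k , count , odd) = aut-≈ h σ , o′ , k , count , odd
    where
    o′ : Orientation B
    o′ = record { O = O o ; O-E = λ i j x → to (proj₂ h i j) (O-E o i j x)
                ; O-tot = λ i j x → O-tot o i j (from (proj₂ h i j) x) ; O-anti = O-anti o }

  subCount-≈ : {F H H′ : Graph n} {k : ℕ} → H ≈G H′ → SubCount F H k → SubCount F H′ k
  subCount-≈ h = count-resp (λ _ → transport h) (λ _ → transport (≈G-sym h))
    where
    transport : ∀ {F H H′ c} → H ≈G H′ → InSub F H c → InSub F H′ c
    transport (v , e) (w , (sv , se) , iso) = w , ((λ i → to (v i) ∘ sv i) , λ i j → to (e i j) ∘ se i j) , iso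

  inSub-resp : {F H : Graph n} {c d : Candidate n} → Setoid._≈_ (Enumeration.CandidateS n) c d →
               InSub F H c → InSub F H d
  inSub-resp {c = c} {d} (v≡ , e≡) (w , (sv , se) , iso) =
    wf-≈ c≈d w , ((λ i → sv i ∘ from (proj₁ c≈d i)) , λ i j → se i j ∘ from (proj₂ c≈d i j)) ,
    iso-∘ (≈G⇒Iso (≈G-sym c≈d)) iso
    where
    c≈d : toGraph c ≈G toGraph d
    c≈d = (λ i → mk⇔ (subst T (v≡ i)) (subst T (sym (v≡ i)))) ,
          (λ i j → mk⇔ (subst T (e≡ i j)) (subst T (sym (e≡ i j))))

-- Rank the vertices by
-- rank x = min(x, τ x) and orient every edge from the lexicographically
-- smaller pair (rank, index) to the larger one.
-- As τ preserves ranks, τ reverses an edge only if its endpoints have equal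
-- rank, i.e. are τ-partners; so τ reverses exactly the edge a₀b₀.

module OddCriterion {n : ℕ} (H : Graph n) (wf : WellFormed H) (τ : Fin n → Fin n)
  (τ-V : ∀ a → V H a → V H (τ a)) (τ-invol : ∀ a → V H a → τ (τ a) ≡ a)
  (τ-E : ∀ a b → E H a b → E H (τ a) (τ b))
  {a₀ b₀ : Fin n} (e₀ : E H a₀ b₀) (τa₀ : τ a₀ ≡ b₀)
  (only-e₀ : ∀ a b → E H a b → τ a ≡ b → (a ≡ a₀ × b ≡ b₀) ⊎ (a ≡ b₀ × b ≡ a₀)) where

  open import Data.Nat using (_⊓_)
  open import Data.Nat.Properties using (<-cmp; <-asym; <-irrefl; ⊓-sel; ⊓-comm)
  open import Data.Fin using (toℕ; _≟_)
  open import Data.Fin.Properties using (toℕ-injective)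
  open import Data.Product.Properties using (≡-dec)
  open import Data.List.Relation.Unary.Unique.Propositional.Properties using (cartesianProduct⁺; allFin⁺)
  open import Data.List.Membership.Propositional.Properties using (∈-cartesianProduct⁺; ∈-allFin)
  open import Relation.Binary using (tri<; tri≈; tri>)
  open import Relation.Binary.PropositionalEquality using (subst₂)
  open WellFormed wf

  V-left : ∀ {a b} → E H a b → V H a
  V-left e = E-V _ _ e

  V-right : ∀ {a b} → E H a b → V H b
  V-right e = E-V _ _ (E-sym _ _ e)

  τb₀ : τ b₀ ≡ a₀
  τb₀ = trans (cong τ (sym τa₀)) (τ-invol a₀ (V-left e₀))

  rank : Fin n → ℕ
  rank x = toℕ x ⊓ toℕ (τ x)

  rank-τ : ∀ x → V H x → rank (τ x) ≡ rank x
  rank-τ x vx = trans (cong (λ z → toℕ (τ x) ⊓ toℕ z) (τ-invol x vx)) (⊓-comm (toℕ (τ x)) (toℕ x))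

  same-rank : ∀ a b → V H a → V H b → rank a ≡ rank b → a ≡ b ⊎ τ a ≡ b
  same-rank a b va vb eq with ⊓-sel (toℕ a) (toℕ (τ a)) | ⊓-sel (toℕ b) (toℕ (τ b))
  ... | inj₁ p | inj₁ q = inj₁ (toℕ-injective (trans (sym p) (trans eq q)))
  ... | inj₁ p | inj₂ q = inj₂ (trans (cong τ (toℕ-injective (trans (sym p) (trans eq q)))) (τ-invol b vb))
  ... | inj₂ p | inj₁ q = inj₂ (toℕ-injective (trans (sym p) (trans eq q)))
  ... | inj₂ p | inj₂ q = inj₁ (trans (sym (τ-invol a va))
                                 (trans (cong τ (toℕ-injective (trans (sym p) (trans eq q)))) (τ-invol b vb)))

  _≺_ : Fin n → Fin n → Set
  a ≺ b = rank a < rank b ⊎ (rank a ≡ rank b × toℕ a < toℕ b)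

  ≺-asym : ∀ {a b} → a ≺ b → ¬ b ≺ a
  ≺-asym (inj₁ p)       (inj₁ q)       = <-asym p q
  ≺-asym (inj₁ p)       (inj₂ (q , _)) = <-irrefl (sym q) p
  ≺-asym (inj₂ (p , _)) (inj₁ q)       = <-irrefl (sym p) q
  ≺-asym (inj₂ (_ , p)) (inj₂ (_ , q)) = <-asym p q

  ≺-total : ∀ a b → a ≢ b → a ≺ b ⊎ b ≺ a
  ≺-total a b a≢b with <-cmp (rank a) (rank b)
  ... | tri< p _ _ = inj₁ (inj₁ p)
  ... | tri> _ _ p = inj₂ (inj₁ p)
  ... | tri≈ _ e _ with <-cmp (toℕ a) (toℕ b)
  ...   | tri< p _ _  = inj₁ (inj₂ (e , p))
  ...   | tri≈ _ e′ _ = ⊥-elim (a≢b (toℕ-injective e′))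
  ...   | tri> _ _ p  = inj₂ (inj₂ (sym e , p))

  orientation : Orientation H
  orientation = record
    { O      = λ a b → E H a b × a ≺ b
    ; O-E    = λ _ _ → proj₁
    ; O-tot  = λ a b e → Sum.map (e ,_) (E-sym a b e ,_) (≺-total a b λ { refl → E-irr a e })
    ; O-anti = λ _ _ (_ , a≺b) (_ , b≺a) → ≺-asym a≺b b≺a }

  τ-aut : Aut H
  τ-aut = record
    { φ = τ ; ψ = τ ; φ-V = τ-V ; ψ-V = τ-V ; ψφ = τ-invol ; φψ = τ-invol
    ; φ-E = λ i j vi vj → mk⇔ (τ-E i j) (λ e → subst₂ (E H) (τ-invol i vi) (τ-invol j vj) (τ-E (τ i) (τ j) e)) }

  Rev : Fin n × Fin n → Set
  Rev = Reversed τ-aut orientation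

  reversed⇒partners : ∀ a b → E H a b → a ≺ b → τ b ≺ τ a → τ a ≡ b
  reversed⇒partners a b e a≺b τb≺τa with same-rank a b (V-left e) (V-right e) (equal-rank a≺b τb≺τa)
    where
    equal-rank : a ≺ b → τ b ≺ τ a → rank a ≡ rank b
    equal-rank (inj₂ (eq , _)) _                 = eq
    equal-rank (inj₁ a<b) (inj₁ τb<τa)           =
      ⊥-elim (<-asym a<b (subst₂ _<_ (rank-τ b (V-right e)) (rank-τ a (V-left e)) τb<τa))
    equal-rank (inj₁ a<b) (inj₂ (τb≡τa , _))     =
      ⊥-elim (<-irrefl (sym (subst₂ _≡_ (rank-τ b (V-right e)) (rank-τ a (V-left e)) τb≡τa)) a<b)
  ... | inj₁ refl = ⊥-elim (E-irr a e)
  ... | inj₂ τa≡b = τa≡b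

  oriented : a₀ ≺ b₀ ⊎ b₀ ≺ a₀ → Fin n × Fin n
  oriented (inj₁ _) = a₀ , b₀
  oriented (inj₂ _) = b₀ , a₀

  a₀≢b₀ : a₀ ≢ b₀
  a₀≢b₀ refl = E-irr a₀ e₀

  p₀ : Fin n × Fin n
  p₀ = oriented (≺-total a₀ b₀ a₀≢b₀)

  oriented-unique : ∀ a b → a ≺ b → (a ≡ a₀ × b ≡ b₀) ⊎ (a ≡ b₀ × b ≡ a₀) →
                    ∀ d → (a , b) ≡ oriented d
  oriented-unique a b a≺b (inj₁ (refl , refl)) (inj₁ _)   = refl
  oriented-unique a b a≺b (inj₁ (refl , refl)) (inj₂ b≺a) = ⊥-elim (≺-asym a≺b b≺a)
  oriented-unique a b a≺b (inj₂ (refl , refl)) (inj₁ b≺a) = ⊥-elim (≺-asym a≺b b≺a)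
  oriented-unique a b a≺b (inj₂ (refl , refl)) (inj₂ _)   = refl

  only-p₀ : ∀ p → Rev p → p ≡ p₀
  only-p₀ (a , b) ((e , a≺b) , (_ , τb≺τa)) =
    oriented-unique a b a≺b (only-e₀ a b e (reversed⇒partners a b e a≺b τb≺τa)) _

  p₀-reversed : Rev p₀
  p₀-reversed with ≺-total a₀ b₀ a₀≢b₀
  ... | inj₁ a₀≺b₀ = (e₀ , a₀≺b₀) ,
                     subst₂ (λ x y → E H x y × x ≺ y) (sym τb₀) (sym τa₀) (e₀ , a₀≺b₀)
  ... | inj₂ b₀≺a₀ = (E-sym _ _ e₀ , b₀≺a₀) ,
                     subst₂ (λ x y → E H x y × x ≺ y) (sym τa₀) (sym τb₀) (E-sym _ _ e₀ , b₀≺a₀)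

  odd : OddGraph H
  odd = τ-aut , orientation , 1 ,
    count-single (≡-dec _≟_ _≟_) only-p₀ p₀-reversed
      (cartesianProduct⁺ (allFin⁺ n) (allFin⁺ n)) (∈-cartesianProduct⁺ (∈-allFin _) (∈-allFin _)) ,
    refl

odd-by-conjugation : ∀ {n m} (K : Graph n) (F : Graph m) → WellFormed K → WellFormed F → Iso K F →
  (ι : Fin n → Fin n) → (∀ x → V K x → V K (ι x)) → (∀ x → V K x → ι (ι x) ≡ x) →
  (∀ a b → E K a b → E K (ι a) (ι b)) → ∀ {u v} → E K u v → ι u ≡ v →
  (∀ a b → E K a b → ι a ≡ b → (a ≡ u × b ≡ v) ⊎ (a ≡ v × b ≡ u)) → OddGraph F
odd-by-conjugation {m = m} K F wfK wfF iso ι ι-V ι-invol ι-E {u} {v} uv ι-u only-uv =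
  OddCriterion.odd F wfF τ τ-V τ-invol τ-E (to (φ-E iso u v Vu Vv) uv) τ-u only-φuv
  where
  open import Relation.Binary.PropositionalEquality using (subst₂)
  open WellFormed wfK using () renaming (E-V to K-V; E-sym to K-sym)
  open WellFormed wfF using () renaming (E-V to F-V; E-sym to F-sym)

  Vu : V K u
  Vu = K-V u v uv
  Vv : V K v
  Vv = K-V v u (K-sym u v uv)

  τ : Fin m → Fin m
  τ a = φ iso (ι (ψ iso a))

  ιψ-V : ∀ a → V F a → V K (ι (ψ iso a))
  ιψ-V a va = ι-V _ (ψ-V iso a va)

  τ-V : ∀ a → V F a → V F (τ a)
  τ-V a va = φ-V iso _ (ιψ-V a va)

  τ-invol : ∀ a → V F a → τ (τ a) ≡ a
  τ-invol a va = trans (cong (φ iso ∘ ι) (ψφ iso _ (ιψ-V a va)))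
                       (trans (cong (φ iso) (ι-invol _ (ψ-V iso a va))) (φψ iso a va))

  ψ-E : ∀ {a b} → E F a b → E K (ψ iso a) (ψ iso b)
  ψ-E {a} {b} e = from (φ-E iso _ _ (ψ-V iso a va) (ψ-V iso b vb))
                       (subst₂ (E F) (sym (φψ iso a va)) (sym (φψ iso b vb)) e)
    where
    va : V F a
    va = F-V a b e
    vb : V F b
    vb = F-V b a (F-sym a b e)

  τ-E : ∀ a b → E F a b → E F (τ a) (τ b)
  τ-E a b e = to (φ-E iso _ _ (ιψ-V a (F-V a b e)) (ιψ-V b (F-V b a (F-sym a b e)))) (ι-E _ _ (ψ-E e))

  τ-u : τ (φ iso u) ≡ φ iso v
  τ-u = cong (φ iso) (trans (cong ι (ψφ iso u Vu)) ι-u)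

  φψ≡ : ∀ {a x} → V F a → ψ iso a ≡ x → a ≡ φ iso x
  φψ≡ {a} va refl = sym (φψ iso a va)

  only-φuv : ∀ a b → E F a b → τ a ≡ b → (a ≡ φ iso u × b ≡ φ iso v) ⊎ (a ≡ φ iso v × b ≡ φ iso u)
  only-φuv a b e τa≡b with only-uv _ _ (ψ-E e) ιψa≡ψb
    where
    ιψa≡ψb : ι (ψ iso a) ≡ ψ iso b
    ιψa≡ψb = trans (sym (ψφ iso _ (ιψ-V a (F-V a b e)))) (cong (ψ iso) τa≡b)
  ... | inj₁ (p , q) = inj₁ (φψ≡ (F-V a b e) p , φψ≡ (F-V b a (F-sym a b e)) q)
  ... | inj₂ (p , q) = inj₂ (φψ≡ (F-V a b e) p , φψ≡ (F-V b a (F-sym a b e)) q)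

module Paths {n : ℕ} (R : Fin n → Fin n → Set) where
  open import Data.Fin using (inject₁; fromℕ; _≟_)
  open import Data.Fin.Properties using (any?)
  open import Data.Unit using (⊤; tt)

  data Walk : ℕ → Fin n → Fin n → Set where
    []  : ∀ {a} → Walk 0 a a
    _∷_ : ∀ {a x b m} → R a x → Walk m x b → Walk (suc m) a b

  vertex : ∀ {m a b} → Walk m a b → Fin (suc m) → Fin n
  vertex {a = a} w        zero    = a
  vertex         (r ∷ w) (suc i) = vertex w i

  IsPath : ∀ {m a b} → Walk m a b → Set
  IsPath []              = ⊤
  IsPath (_∷_ {a} r w) = (∀ i → vertex w i ≢ a) × IsPath w

  Path : Fin n → Fin n → Set
  Path a b = Σ ℕ λ m → Σ (Walk m a b) IsPath

  suffix : ∀ {m a b} (w : Walk m a b) → IsPath w → (i : Fin (suc m)) → Path (vertex w i) b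
  suffix w       p       zero    = _ , w , p
  suffix (r ∷ w) (_ , p) (suc i) = suffix w p i

  loop-erase : ∀ {a b} → Star R a b → Path a b
  loop-erase ε = 0 , [] , tt
  loop-erase {a} (r ◅ s) with loop-erase s
  ... | m , w , p with any? (λ i → vertex w i ≟ a)
  ... | yes′ (i , refl) = suffix w p i
  ... | no′ a∉w          = suc m , r ∷ w , (λ i e → a∉w (i , e)) , p

  vertex-injective : ∀ {m a b} (w : Walk m a b) → IsPath w → ∀ i j → vertex w i ≡ vertex w j → i ≡ j
  vertex-injective w       _       zero    zero    e = refl
  vertex-injective (r ∷ w) (d , _) zero    (suc j) e = ⊥-elim (d j (sym e))
  vertex-injective (r ∷ w) (d , _) (suc i) zero    e = ⊥-elim (d i e)
  vertex-injective (r ∷ w) (_ , p) (suc i) (suc j) e = cong suc (vertex-injective w p i j e)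

  vertex-step : ∀ {m a b} (w : Walk m a b) (i : Fin m) → R (vertex w (inject₁ i)) (vertex w (suc i))
  vertex-step (r ∷ w) zero    = r
  vertex-step (r ∷ w) (suc i) = vertex-step w i

  vertex-last : ∀ {m a b} (w : Walk m a b) → vertex w (fromℕ m) ≡ b
  vertex-last []      = refl
  vertex-last (r ∷ w) = vertex-last w

module ForestTheory {n : ℕ} (G : Graph n) (wf : WellFormed G) (acyclic : ¬ Cycle G) where
  open WellFormed wf
  open import Data.Fin using (_≟_)
  open import Relation.Binary.PropositionalEquality using (subst₂)
  import Relation.Binary.Construct.Closure.ReflexiveTransitive as Star
  open Paths using (_∷_; vertex; vertex-injective; vertex-step; vertex-last)

  snoc : ∀ {R : Fin n → Fin n → Set} {a b c} → Star R a b → R b c → Star R a c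
  snoc p r = p ◅◅ (r ◅ ε)

  star-sym : ∀ {a b} → Star (E G) a b → Star (E G) b a
  star-sym = Star.reverse (E-sym _ _)

  same-pair? : ∀ (x y a b : Fin n) → Dec (x ≡ a × y ≡ b)
  same-pair? x y a b with x ≟ a | y ≟ b
  ... | yes′ p | yes′ q = yes′ (p , q)
  ... | no′ p  | _      = no′ (p ∘ proj₁)
  ... | _      | no′ q  = no′ (q ∘ proj₂)

  Avoid : Fin n → Fin n → Fin n → Fin n → Set
  Avoid a b x y = E G x y × ¬ (x ≡ a × y ≡ b) × ¬ (x ≡ b × y ≡ a)

  avoid-sym : ∀ {a b x y} → Avoid a b x y → Avoid a b y x
  avoid-sym (e , ≢ab , ≢ba) = E-sym _ _ e , (λ (p , q) → ≢ba (q , p)) , (λ (p , q) → ≢ab (q , p))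

  avoid-swap : ∀ {a b x y} → Avoid a b x y → Avoid b a x y
  avoid-swap (e , ≢ab , ≢ba) = e , ≢ba , ≢ab

  Side : Fin n → Fin n → Fin n → Set
  Side a b x = Star (Avoid a b) a x

  -- in a forest an edge is the only connection between its endpoints: a path
  -- from u to v avoiding uv has at least two steps, and with vu it closes a cycle
  no-detour : ∀ {u v} → E G u v → ¬ Star (Avoid u v) u v
  no-detour {u} {v} e p with Paths.loop-erase (Avoid u v) p
  ... | _ , Paths.[] , _                  = E-irr u e
  ... | _ , (r ∷ Paths.[]) , _            = proj₁ (proj₂ r) (refl , refl)
  ... | _ , w@(_∷_ {m = suc len} _ _) , d = acyclic record
    { len   = len
    ; c     = vertex (Avoid u v) w
    ; inj   = λ {i} {j} → vertex-injective (Avoid u v) w d i j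
    ; step  = λ i → proj₁ (vertex-step (Avoid u v) w i)
    ; close = subst (λ z → E G z u) (sym (vertex-last (Avoid u v) w)) (E-sym _ _ e) }

  sides-disjoint : ∀ {u v x} → E G u v → Side u v x → Side v u x → ⊥
  sides-disjoint e p q = no-detour e (p ◅◅ Star.reverse avoid-sym (Star.map avoid-swap q))

  side-step : ∀ {u v y z} → Side u v y ⊎ Side v u y → E G y z → Side u v z ⊎ Side v u z
  side-step {u} {v} {y} {z} s e with same-pair? y z u v | same-pair? y z v u
  ... | yes′ (refl , refl) | _                  = inj₂ ε
  ... | no′ _              | yes′ (refl , refl) = inj₁ ε
  ... | no′ ≢uv            | no′ ≢vu with s
  ...   | inj₁ p = inj₁ (snoc p (e , ≢uv , ≢vu))
  ...   | inj₂ p = inj₂ (snoc p (e , ≢vu , ≢uv))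

  side-partition : ∀ {u v x} → Star (E G) u x → Side u v x ⊎ Side v u x
  side-partition = go (inj₁ ε)
    where
    go : ∀ {u v y x} → Side u v y ⊎ Side v u y → Star (E G) y x → Side u v x ⊎ Side v u x
    go s ε       = s
    go s (e ◅ p) = go (side-step s e) p

  Reach : Fin n → Fin n → Set
  Reach r x = V G r × Star (E G) r x

  reach-step : ∀ {r x y} → Reach r x → E G x y → Reach r y
  reach-step (vr , p) e = vr , snoc p e

  reach-V : ∀ {r x} → Reach r x → V G x
  reach-V (vr , p) = go vr p
    where
    go : ∀ {x y} → V G x → Star (E G) x y → V G y
    go vx ε       = vx
    go vx (e ◅ p) = go (E-V _ _ (E-sym _ _ e)) p

  reach-rebase : ∀ {r r′} → Reach r r′ → ∀ {x} → Reach r x → Reach r′ x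
  reach-rebase rr′ (_ , p) = reach-V rr′ , (star-sym (proj₂ rr′) ◅◅ p)

  reach-flip : ∀ {r x} → Reach r x → Reach x r
  reach-flip rx = reach-V rx , star-sym (proj₂ rx)

  record Mirror (r u v : Fin n) : Set where
    field
      uv : E G u v
      ru : Reach r u
      σ ρ : Fin n → Fin n
      σR  : ∀ x → Reach r x → Reach r (σ x)
      ρR  : ∀ x → Reach r x → Reach r (ρ x)
      ρσ  : ∀ x → Reach r x → ρ (σ x) ≡ x
      σρ  : ∀ x → Reach r x → σ (ρ x) ≡ x
      σE  : ∀ x y → Reach r x → E G x y → E G (σ x) (σ y)
      ρE  : ∀ x y → Reach r x → E G x y → E G (ρ x) (ρ y)
      σu  : σ u ≡ v
      σv  : σ v ≡ u

  module _ {r u v : Fin n} (M : Mirror r u v) where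
    open Mirror M

    rv : Reach r v
    rv = reach-step ru uv

    ρv : ρ v ≡ u
    ρv = trans (cong ρ (sym σu)) (ρσ u ru)

    ρu : ρ u ≡ v
    ρu = trans (cong ρ (sym σv)) (ρσ v rv)

    mirror-swap : Mirror r v u
    mirror-swap = record { Mirror M ; uv = E-sym _ _ uv ; ru = rv ; σu = σv ; σv = σu }

    mirror-inv : Mirror r v u
    mirror-inv = record
      { uv = E-sym _ _ uv ; ru = rv ; σ = ρ ; ρ = σ ; σR = ρR ; ρR = σR
      ; ρσ = σρ ; σρ = ρσ ; σE = ρE ; ρE = σE ; σu = ρv ; σv = ρu }

    mirror-rebase : ∀ {r′} → Reach r r′ → Mirror r′ u v
    mirror-rebase rr′ = record
      { Mirror M
      ; ru = fwd ru
      ; σR = λ x → fwd ∘ σR x ∘ bwd ; ρR = λ x → fwd ∘ ρR x ∘ bwd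
      ; ρσ = λ x → ρσ x ∘ bwd ; σρ = λ x → σρ x ∘ bwd
      ; σE = λ x y → σE x y ∘ bwd ; ρE = λ x y → ρE x y ∘ bwd }
      where
      fwd : ∀ {x} → Reach r x → Reach _ x
      fwd = reach-rebase rr′
      bwd : ∀ {x} → Reach _ x → Reach r x
      bwd = reach-rebase (reach-flip rr′)

    side-reach : ∀ {x} → Side u v x → Reach r x
    side-reach p = proj₁ ru , (proj₂ ru ◅◅ Star.map proj₁ p)

    σ-side : ∀ {x} → Side u v x → Side v u (σ x)
    σ-side p = subst (λ z → Star (Avoid v u) z _) σu (go ru p)
      where
      unσ : ∀ {x w w′} → Reach r x → σ x ≡ w → ρ w ≡ w′ → x ≡ w′
      unσ {x} rx σx≡w ρw≡w′ = trans (sym (ρσ x rx)) (trans (cong ρ σx≡w) ρw≡w′)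
      go : ∀ {y x} → Reach r y → Star (Avoid u v) y x → Star (Avoid v u) (σ y) (σ x)
      go ry ε = ε
      go ry (_◅_ {j = z} (e , ≢uv , ≢vu) p) =
        (σE _ _ ry e ,
         (λ (p , q) → ≢uv (unσ ry p ρv , unσ rz q ρu)) ,
         (λ (p , q) → ≢vu (unσ ry p ρu , unσ rz q ρv))) ◅ go rz p
        where
        rz : Reach r z
        rz = reach-step ry e

  -- Suppose uv and ab are mirrored edges of one
  -- component with a on the u-side of uv and u on the a-side of ab.  Then
  -- f = σ₁ ∘ σ₂ maps the a-side of ab injectively into the v-side of uv, which
  -- is contained in the a-side of ab but misses u.  Iterating f from u must
  -- repeat a vertex (pigeonhole), and cancelling puts u on the v-side.
  module NoSecondMirror {r u v a b : Fin n} (M₁ : Mirror r u v) (M₂ : Mirror r a b)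
    (a∈Tu : Side u v a) (u∈Sa : Side a b u) (≢uv : ¬ (a ≡ u × b ≡ v)) (≢vu : ¬ (a ≡ v × b ≡ u)) where
    open import Data.Nat using (_∸_)
    open import Data.Nat.Properties using (n<1+n; m+[n∸m]≡n)
    open import Data.Fin using (toℕ)
    open import Data.Fin.Properties using (pigeonhole)
    open Mirror M₁ using () renaming (uv to e₁; σ to σ₁; ρ to ρ₁; ρσ to ρσ₁)
    open Mirror M₂ using () renaming (uv to e₂; σ to σ₂; ρ to ρ₂; ρσ to ρσ₂)

    ab-avoids-uv : Avoid u v a b
    ab-avoids-uv = e₂ , ≢uv , ≢vu

    uv-avoids-ab : Avoid a b u v
    uv-avoids-ab = e₁ , (λ (p , q) → ≢uv (sym p , sym q)) , (λ (p , q) → ≢vu (sym q , sym p))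

    b∈Tu : Side u v b
    b∈Tu = snoc a∈Tu ab-avoids-uv

    Tv⊆Sa : ∀ {x} → Side v u x → Side a b x
    Tv⊆Sa = go ε (snoc u∈Sa uv-avoids-ab)
      where
      go : ∀ {y x} → Side v u y → Side a b y → Star (Avoid v u) y x → Side a b x
      go ty sy ε = sy
      go ty sy ((e , ≢₁ , ≢₂) ◅ p) = go (snoc ty (e , ≢₁ , ≢₂)) (snoc sy (e , m₁ , m₂)) p
        where
        m₁ : ¬ (_ ≡ a × _ ≡ b)
        m₁ (refl , _) = sides-disjoint e₁ a∈Tu ty
        m₂ : ¬ (_ ≡ b × _ ≡ a)
        m₂ (refl , _) = sides-disjoint e₁ b∈Tu ty

    Sb⊆Tu : ∀ {x} → Side b a x → Side u v x
    Sb⊆Tu p with side-partition {u} {v} (Star.map proj₁ b∈Tu ◅◅ Star.map proj₁ p)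
    ... | inj₁ t  = t
    ... | inj₂ t′ = ⊥-elim (sides-disjoint e₂ (Tv⊆Sa t′) p)

    f : Fin n → Fin n
    f x = σ₁ (σ₂ x)

    f-Sa : ∀ {x} → Side a b x → Side v u (f x)
    f-Sa p = σ-side M₁ (Sb⊆Tu (σ-side M₂ p))

    f-injective : ∀ {x y} → Side a b x → Side a b y → f x ≡ f y → x ≡ y
    f-injective {x} {y} px py fx≡fy = trans (sym (ρσ₂ x (side-reach M₂ px)))
      (trans (cong ρ₂ σ₂x≡σ₂y) (ρσ₂ y (side-reach M₂ py)))
      where
      σ₂x≡σ₂y : σ₂ x ≡ σ₂ y
      σ₂x≡σ₂y = trans (sym (ρσ₁ _ (side-reach (mirror-swap M₂) (σ-side M₂ px))))
        (trans (cong ρ₁ fx≡fy) (ρσ₁ _ (side-reach (mirror-swap M₂) (σ-side M₂ py))))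

    iterate : ℕ → Fin n
    iterate zero    = u
    iterate (suc k) = f (iterate k)

    iterate-Sa : ∀ k → Side a b (iterate k)
    iterate-Sa zero    = u∈Sa
    iterate-Sa (suc k) = Tv⊆Sa (f-Sa (iterate-Sa k))

    cancel : ∀ i d → iterate i ≡ iterate (i + suc d) → u ≡ iterate (suc d)
    cancel zero    d e = e
    cancel (suc i) d e = cancel i d (f-injective (iterate-Sa i) (iterate-Sa (i + suc d)) e)

    contradiction : ⊥
    contradiction with pigeonhole (n<1+n n) (iterate ∘ toℕ)
    ... | i , j , i<j , e = sides-disjoint e₁ ε (subst (Side v u) (sym u≡) (f-Sa (iterate-Sa d)))
      where
      d : ℕ
      d = toℕ j ∸ suc (toℕ i)
      u≡ : u ≡ iterate (suc d)
      u≡ = cancel (toℕ i) d (trans e (cong iterate (trans (sym (m+[n∸m]≡n i<j)) (sym (+-suc (toℕ i) d)))))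

  mirror-unique : ∀ {r u v a b} → Mirror r u v → Mirror r a b → (a ≡ u × b ≡ v) ⊎ (a ≡ v × b ≡ u)
  mirror-unique {r} {u} {v} {a} {b} M₁ M₂ with same-pair? a b u v | same-pair? a b v u
  ... | yes′ p  | _       = inj₁ p
  ... | no′ _   | yes′ p  = inj₂ p
  ... | no′ ≢uv | no′ ≢vu = ⊥-elim (cases (side-partition {u} {v} u⇝a) (side-partition {a} {b} (star-sym u⇝a)))
    where
    u⇝a : Star (E G) u a
    u⇝a = star-sym (proj₂ (Mirror.ru M₁)) ◅◅ proj₂ (Mirror.ru M₂)
    flip : ∀ {x y z w} → ¬ (x ≡ y × z ≡ w) → ¬ (z ≡ w × x ≡ y)
    flip ne (p , q) = ne (q , p)
    ab-avoids-uv : Avoid u v a b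
    ab-avoids-uv = Mirror.uv M₂ , ≢uv , ≢vu
    uv-avoids-ab : Avoid a b u v
    uv-avoids-ab = Mirror.uv M₁ , (λ (p , q) → ≢uv (sym p , sym q)) , (λ (p , q) → ≢vu (sym q , sym p))
    open NoSecondMirror using (contradiction)
    cases : Side u v a ⊎ Side v u a → Side a b u ⊎ Side b a u → ⊥
    cases (inj₁ t) (inj₁ s) = contradiction M₁ M₂ t s ≢uv ≢vu
    cases (inj₁ t) (inj₂ s) = contradiction M₁ (mirror-swap M₂) (snoc t ab-avoids-uv) s (flip ≢vu) (flip ≢uv)
    cases (inj₂ t) (inj₁ s) = contradiction (mirror-swap M₁) M₂ t (snoc s uv-avoids-ab) ≢vu ≢uv
    cases (inj₂ t) (inj₂ s) = contradiction (mirror-swap M₁) (mirror-swap M₂)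
      (snoc t (avoid-swap ab-avoids-uv)) (snoc s (avoid-swap uv-avoids-ab)) (flip ≢uv) (flip ≢vu)

  -- The involution ι of a mirror-bridge uv: σ on the side of u, ρ = σ⁻¹ on
  -- the side of v, and the identity off the component.  (Membership in a
  -- side is assumed decidable; it is, classically.)
  module MirrorInvolution {u v : Fin n} (M : Mirror u u v) (side? : ∀ a b x → Dec (Side a b x)) where
    open Mirror M

    data Position (x : Fin n) : Set where
      u-side  : Side u v x → Position x
      v-side  : ¬ Side u v x → Side v u x → Position x
      outside : ¬ Side u v x → ¬ Side v u x → Position x

    position : ∀ x → Position x
    position x with side? u v x | side? v u x
    ... | yes′ t  | _       = u-side t
    ... | no′ ¬tu | yes′ t  = v-side ¬tu t
    ... | no′ ¬tu | no′ ¬tv = outside ¬tu ¬tv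

    ι : Fin n → Fin n
    ι x with position x
    ... | u-side _    = σ x
    ... | v-side _ _  = ρ x
    ... | outside _ _ = x

    ι-on-u-side : ∀ {x} → Side u v x → ι x ≡ σ x
    ι-on-u-side {x} t with position x
    ... | u-side _      = refl
    ... | v-side ¬t _   = ⊥-elim (¬t t)
    ... | outside ¬t _  = ⊥-elim (¬t t)

    ι-on-v-side : ∀ {x} → Side v u x → ι x ≡ ρ x
    ι-on-v-side {x} t with position x
    ... | u-side t′     = ⊥-elim (sides-disjoint uv t′ t)
    ... | v-side _ _    = refl
    ... | outside _ ¬t  = ⊥-elim (¬t t)

    ι-outside : ∀ {x} → ¬ Side u v x → ¬ Side v u x → ι x ≡ x
    ι-outside {x} ¬tu ¬tv with position x
    ... | u-side t     = ⊥-elim (¬tu t)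
    ... | v-side _ t   = ⊥-elim (¬tv t)
    ... | outside _ _  = refl

    outside-step : ∀ {x y} → E G x y → ¬ Side u v x → ¬ Side v u x → ¬ Side u v y × ¬ Side v u y
    outside-step e ¬tu ¬tv =
      (λ t → escape (side-step (inj₁ t) (E-sym _ _ e))) , (λ t → escape (side-step (inj₂ t) (E-sym _ _ e)))
      where
      escape : Side u v _ ⊎ Side v u _ → ⊥
      escape (inj₁ t) = ¬tu t
      escape (inj₂ t) = ¬tv t

    ι-u : ι u ≡ v
    ι-u = trans (ι-on-u-side ε) σu

    ι-v : ι v ≡ u
    ι-v = trans (ι-on-v-side ε) (ρv M)

    ι-invol : ∀ x → ι (ι x) ≡ x
    ι-invol x with position x
    ... | u-side t      = trans (ι-on-v-side (σ-side M t)) (ρσ x (side-reach M t))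
    ... | v-side _ t    = trans (ι-on-u-side (σ-side (mirror-inv M) t)) (σρ x (side-reach (mirror-swap M) t))
    ... | outside ¬tu ¬tv = ι-outside ¬tu ¬tv

    ι-V : ∀ {x} → V G x → V G (ι x)
    ι-V {x} vx with position x
    ... | u-side t    = reach-V (σR _ (side-reach M t))
    ... | v-side _ t  = reach-V (ρR _ (side-reach (mirror-swap M) t))
    ... | outside _ _ = vx

    ι-reach : ∀ {x} → Reach u x → Reach u (ι x)
    ι-reach {x} rx with side-partition {u} {v} (proj₂ rx)
    ... | inj₁ t = subst (Reach u) (sym (ι-on-u-side t)) (σR _ rx)
    ... | inj₂ t = subst (Reach u) (sym (ι-on-v-side t)) (ρR _ rx)

    ι-E : ∀ {a b} → E G a b → E G (ι a) (ι b)
    ι-E {a} {b} e with same-pair? a b u v | same-pair? a b v u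
    ... | yes′ (refl , refl) | _ = subst₂ (E G) (sym ι-u) (sym ι-v) (E-sym _ _ e)
    ... | no′ _ | yes′ (refl , refl) = subst₂ (E G) (sym ι-v) (sym ι-u) (E-sym _ _ e)
    ... | no′ ≢uv | no′ ≢vu = off-bridge (position a)
      where
      off-bridge : Position a → E G (ι a) (ι b)
      off-bridge (u-side t) = subst₂ (E G) (sym (ι-on-u-side t)) (sym (ι-on-u-side (snoc t (e , ≢uv , ≢vu))))
        (σE a b (side-reach M t) e)
      off-bridge (v-side _ t) = subst₂ (E G) (sym (ι-on-v-side t)) (sym (ι-on-v-side (snoc t (e , ≢vu , ≢uv))))
        (ρE a b (side-reach (mirror-swap M) t) e)
      off-bridge (outside ¬tu ¬tv) =
        subst₂ (E G) (sym (ι-outside ¬tu ¬tv)) (sym (uncurry ι-outside (outside-step e ¬tu ¬tv))) e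

    ι-swaps-only-uv : ∀ {a b} → E G a b → ι a ≡ b → (a ≡ u × b ≡ v) ⊎ (a ≡ v × b ≡ u)
    ι-swaps-only-uv {a} {b} e ιa≡b with same-pair? a b u v | same-pair? a b v u
    ... | yes′ p  | _       = inj₁ p
    ... | no′ _   | yes′ p  = inj₂ p
    ... | no′ ≢uv | no′ ≢vu = ⊥-elim (off-bridge (position a))
      where
      off-bridge : ¬ Position a
      off-bridge (u-side t) = sides-disjoint uv (snoc t (e , ≢uv , ≢vu))
        (subst (Side v u) (trans (sym (ι-on-u-side t)) ιa≡b) (σ-side M t))
      off-bridge (v-side _ t) = sides-disjoint uv
        (subst (Side u v) (trans (sym (ι-on-v-side t)) ιa≡b) (σ-side (mirror-inv M) t))
        (snoc t (e , ≢vu , ≢uv))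
      off-bridge (outside ¬tu ¬tv) = E-irr a (subst (E G a) (sym (trans (sym (ι-outside ¬tu ¬tv)) ιa≡b)) e)

  mirror-of-bridge : ∀ {r u v} → MirrorBridge (component G r) u v → Mirror r u v
  mirror-of-bridge {r} {u} {v} ((e , r⇝u) , s , su , sv) = record
    { uv = e ; ru = ru ; σ = φ s ; ρ = ψ s
    ; σR = φ-V s ; ρR = ψ-V s ; ρσ = ψφ s ; σρ = φψ s
    ; σE = λ x y rx e → proj₁ (to (φ-E s x y rx (reach-step rx e)) (e , proj₂ rx))
    ; ρE = λ x y rx e → let ry = reach-step rx e in
        proj₁ (from (φ-E s (ψ s x) (ψ s y) (ψ-V s x rx) (ψ-V s y ry))
          (subst₂ (E (component G r)) (sym (φψ s x rx)) (sym (φψ s y ry)) (e , proj₂ rx)))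
    ; σu = su ; σv = sv }
    where
    ru : Reach r u
    ru = reach-V (E-V u v e , star-sym r⇝u) , r⇝u

  Mirrors : List (Fin n × Fin n) → Set
  Mirrors = All (λ (p , q) → Mirror p p q)

module _ {n : ℕ} where
  open import Data.List.Membership.Propositional using (_∈_)

  Listed : List (Fin n × Fin n) → Fin n → Fin n → Set
  Listed X a b = (a , b) ∈ X ⊎ (b , a) ∈ X

  _∖_ : Graph n → List (Fin n × Fin n) → Graph n
  V (H ∖ X) = V H
  E (H ∖ X) a b = E H a b × ¬ Listed X a b

-- The copies of F in G ∖ X that avoid uv are exactly the
-- copies in G ∖ (uv ∷ X); those that use uv are paired up by the involution
-- ι of uv (which preserves G ∖ X, as no listed bridge lies in the component
-- of uv), and a copy fixed by ι would make F odd.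

module RemoveBridge {n : ℕ} (G : Graph n) (wf : WellFormed G) (acyclic : ¬ Cycle G)
  (F : Graph n) (wfF : WellFormed F) (evenF : EvenGraph F)
  (side? : ∀ a b x → Dec (ForestTheory.Side G wf acyclic a b x)) where
  open ForestTheory G wf acyclic
  open Enumeration using (CandidateS; candidates-complete; candidates-unique)
  open import Data.Bool using (T)
  open import Data.List.Membership.Propositional using (_∈_)
  open import Data.List.Relation.Unary.All using () renaming (lookup to lookupAll)
  open import Relation.Binary.PropositionalEquality using (subst₂; cong₂)
  open import Relation.Nullary.Decidable using (T?)

  module Step (X : List (Fin n × Fin n)) (mirrors : Mirrors X)
    {u v : Fin n} (M : Mirror u u v) (uv∉X : ¬ Listed X u v) where
    open MirrorInvolution M side?
    open Setoid (CandidateS n) using (_≈_)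

    listed-near-u : ∀ {p q} → Reach u p → (p , q) ∈ X → Listed X u v
    listed-near-u rp m with mirror-unique M (mirror-rebase (lookupAll mirrors m) (reach-flip rp))
    ... | inj₁ (refl , refl) = inj₁ m
    ... | inj₂ (refl , refl) = inj₂ m

    ι-E∖ : ∀ {a b} → E (G ∖ X) a b → E (G ∖ X) (ι a) (ι b)
    ι-E∖ {a} {b} (e , ab∉X) = ι-E e , unlisted (position a)
      where
      near-u : Reach u a → ¬ Listed X (ι a) (ι b)
      near-u ra (inj₁ m) = uv∉X (listed-near-u (ι-reach ra) m)
      near-u ra (inj₂ m) = uv∉X (listed-near-u (ι-reach (reach-step ra e)) m)
      unlisted : Position a → ¬ Listed X (ι a) (ι b)
      unlisted (u-side t)   = near-u (side-reach M t)
      unlisted (v-side _ t) = near-u (side-reach (mirror-swap M) t)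
      unlisted (outside ¬tu ¬tv) = subst₂ (λ x y → ¬ Listed X x y)
        (sym (ι-outside ¬tu ¬tv)) (sym (uncurry ι-outside (outside-step e ¬tu ¬tv))) ab∉X

    ι* : Candidate n → Candidate n
    ι* c = (λ i → proj₁ c (ι i)) , (λ i j → proj₂ c (ι i) (ι j))

    ι*-cong : ∀ {c d} → c ≈ d → ι* c ≈ ι* d
    ι*-cong (v≡ , e≡) = (λ i → v≡ (ι i)) , (λ i j → e≡ (ι i) (ι j))

    ι*-invol : ∀ c → ι* (ι* c) ≈ c
    ι*-invol c = (λ i → cong (proj₁ c) (ι-invol i)) , (λ i j → cong₂ (proj₂ c) (ι-invol i) (ι-invol j))

    ι-iso : ∀ c → Iso (toGraph (ι* c)) (toGraph c)
    ι-iso c = record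
      { φ = ι ; ψ = ι ; φ-V = λ _ x → x
      ; ψ-V = λ a x → subst (λ z → T (proj₁ c z)) (sym (ι-invol a)) x
      ; ψφ = λ i _ → ι-invol i ; φψ = λ a _ → ι-invol a
      ; φ-E = λ _ _ _ _ → mk⇔ (λ x → x) (λ x → x) }

    UsesUV : Candidate n → Set
    UsesUV c = InSub F (G ∖ X) c × T (proj₂ c u v)

    UsesUV-resp : ∀ {c d} → c ≈ d → UsesUV c → UsesUV d
    UsesUV-resp c≈d (s , t) = inSub-resp c≈d s , subst T (proj₂ c≈d u v) t

    UsesUV-ι* : ∀ c → UsesUV c → UsesUV (ι* c)
    UsesUV-ι* c ((w , (sv , se) , iso) , t) = (w′ , (sv′ , se′) , iso-∘ (ι-iso c) iso) , t′
      where
      open WellFormed w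
      w′ : WellFormed (toGraph (ι* c))
      w′ = record { E-sym = λ i j → E-sym (ι i) (ι j) ; E-irr = λ i → E-irr (ι i)
                  ; E-V = λ i j → E-V (ι i) (ι j) }
      sv′ : ∀ i → T (proj₁ c (ι i)) → V G i
      sv′ i x = subst (V G) (ι-invol i) (ι-V (sv (ι i) x))
      se′ : ∀ i j → T (proj₂ c (ι i) (ι j)) → E (G ∖ X) i j
      se′ i j x = subst₂ (E (G ∖ X)) (ι-invol i) (ι-invol j) (ι-E∖ (se (ι i) (ι j) x))
      t′ : T (proj₂ c (ι u) (ι v))
      t′ = subst₂ (λ a b → T (proj₂ c a b)) (sym ι-u) (sym ι-v) (E-sym u v t)

    -- a copy of F fixed by ι would give F an odd automorphism
    ι*-no-fix : ∀ c → UsesUV c → ¬ ι* c ≈ c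
    ι*-no-fix c ((w , (_ , se) , iso) , t) (v≡ , e≡) = evenF
      (odd-by-conjugation (toGraph c) F w wfF iso ι
        (λ x vx → subst T (sym (v≡ x)) vx) (λ x _ → ι-invol x) (λ a b e → subst T (sym (e≡ a b)) e)
        t ι-u (λ a b e → ι-swaps-only-uv (proj₁ (se a b e))))

    open InvolutionParity (CandidateS n) using (even-count)

    uses-uv-even : ∀ {a} → Count UsesUV (candidates n) a → 2 ∣ a
    uses-uv-even = even-count UsesUV UsesUV-resp ι* ι*-cong ι*-invol UsesUV-ι* ι*-no-fix
      (candidates n) (candidates-unique n) (λ c _ _ → candidates-complete n (ι* c))

    avoids-uv⇒ : ∀ c → InSub F (G ∖ X) c × ¬ T (proj₂ c u v) → InSub F (G ∖ ((u , v) ∷ X)) c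
    avoids-uv⇒ c ((w , (sv , se) , iso) , ¬t) = w , (sv , se′) , iso
      where
      se′ : ∀ i j → T (proj₂ c i j) → E (G ∖ ((u , v) ∷ X)) i j
      se′ i j x = proj₁ (se i j x) , λ
        { (inj₁ (here refl)) → ¬t x
        ; (inj₁ (there m))   → proj₂ (se i j x) (inj₁ m)
        ; (inj₂ (here refl)) → ¬t (WellFormed.E-sym w i j x)
        ; (inj₂ (there m))   → proj₂ (se i j x) (inj₂ m) }

    ⇒avoids-uv : ∀ c → InSub F (G ∖ ((u , v) ∷ X)) c → InSub F (G ∖ X) c × ¬ T (proj₂ c u v)
    ⇒avoids-uv c (w , (sv , se) , iso) = (w , (sv , se′) , iso) , λ x → proj₂ (se u v x) (inj₁ (here refl))
      where
      se′ : ∀ i j → T (proj₂ c i j) → E (G ∖ X) i j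
      se′ i j x = proj₁ (se i j x) , λ
        { (inj₁ m) → proj₂ (se i j x) (inj₁ (there m))
        ; (inj₂ m) → proj₂ (se i j x) (inj₂ (there m)) }

    parity-step : ∀ {k k′} → SubCount F (G ∖ X) k → SubCount F (G ∖ ((u , v) ∷ X)) k′ → k % 2 ≡ k′ % 2
    parity-step ck ck′ with count-split ck (λ c → T? (proj₂ c u v))
    ... | a , b , ca , cb , refl with uses-uv-even ca | count-unique (count-resp avoids-uv⇒ ⇒avoids-uv cb) ck′
    ... | divides h refl | refl = trans (cong (_% 2) (+-comm (h * 2) b)) ([m+kn]%n≡m%n b h 2)

  listed? : ∀ X (a b : Fin n) → Dec (Listed X a b)
  listed? X a b with any? (pair≟ (a , b)) X | any? (pair≟ (b , a)) X
    where
    open import Data.Fin using (_≟_)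
    open import Data.Product.Properties using (≡-dec)
    open import Data.List.Relation.Unary.Any using (any?)
    pair≟ : ∀ (p q : Fin n × Fin n) → Dec (p ≡ q)
    pair≟ = ≡-dec _≟_ _≟_
  ... | yes′ m | _      = yes′ (inj₁ m)
  ... | no′ _  | yes′ m = yes′ (inj₂ m)
  ... | no′ ¬m | no′ ¬m′ = no′ λ { (inj₁ m) → ¬m m ; (inj₂ m) → ¬m′ m }

  ∖[]-≈ : (G ∖ []) ≈G G
  ∖[]-≈ = (λ i → mk⇔ (λ x → x) (λ x → x)) ,
          (λ i j → mk⇔ proj₁ (λ e → e , λ { (inj₁ ()) ; (inj₂ ()) }))

  relist-≈ : ∀ X {u v} → Listed X u v → (G ∖ X) ≈G (G ∖ ((u , v) ∷ X))
  relist-≈ X {u} {v} uv∈X = (λ i → mk⇔ (λ x → x) (λ x → x)) ,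
    (λ i j → mk⇔ (λ (e , ∉X) → e , ∉X ∘ shrink) (λ (e , ∉uvX) → e , ∉uvX ∘ grow))
    where
    grow : ∀ {i j} → Listed X i j → Listed ((u , v) ∷ X) i j
    grow (inj₁ m) = inj₁ (there m)
    grow (inj₂ m) = inj₂ (there m)
    flip : ∀ {i j} → Listed X i j → Listed X j i
    flip (inj₁ m) = inj₂ m
    flip (inj₂ m) = inj₁ m
    shrink : ∀ {i j} → Listed ((u , v) ∷ X) i j → Listed X i j
    shrink (inj₁ (here refl)) = uv∈X
    shrink (inj₁ (there m))   = inj₁ m
    shrink (inj₂ (here refl)) = flip uv∈X
    shrink (inj₂ (there m))   = inj₂ m

  -- removing a list of mirror-bridges preserves |Sub_F| mod 2 (classically,
  -- since the intermediate counts exist only classically)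
  parity-remove : ∀ X → Mirrors X → ∀ {k k′} → SubCount F G k → SubCount F (G ∖ X) k′ →
                  ¬ ¬ (k % 2 ≡ k′ % 2)
  parity-remove [] [] ck ck′ = return (cong (_% 2) (count-unique ck (subCount-≈ ∖[]-≈ ck′)))
  parity-remove ((u , v) ∷ X) (M ∷ ms) {k′ = k′} ck ck′ = do
    (k″ , ck″) ← count-exists (candidates n)
    k≡k″ ← parity-remove X ms ck ck″
    return (trans k≡k″ (last ck″))
    where
    last : ∀ {k″} → SubCount F (G ∖ X) k″ → k″ % 2 ≡ k′ % 2
    last ck″ with listed? X u v
    ... | yes′ uv∈X = cong (_% 2) (count-unique (subCount-≈ (relist-≈ X uv∈X) ck″) ck′)
    ... | no′ uv∉X  = Step.parity-step X ms M uv∉X ck″ ck′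

-- One step of recursive cutting preserves |Sub_F| mod 2: the edges cut from
-- a forest G are the mirror-bridges of its odd components, so listing them
-- (classically) exhibits the next graph as G with a list of mirror-bridges
-- removed.

module CutStepParity {n : ℕ} (G : Graph n) (forest : Forest G) where
  open import Data.List using (filter)
  open import Data.List.Membership.Propositional.Properties
    using (∈-filter⁺; ∈-filter⁻; ∈-cartesianProduct⁺; ∈-allFin)
  open import Data.List.Relation.Unary.All.Properties using (all-filter)
  import Data.List.Relation.Unary.All as All
  wf : WellFormed G
  wf = proj₁ forest
  acyclic : ¬ Cycle G
  acyclic = proj₂ forest
  open WellFormed wf
  open ForestTheory G wf acyclic using (Side; Mirrors; mirror-of-bridge)

  Cut : Fin n → Fin n → Set₁
  Cut a b = OddGraph (component G a) × MirrorBridge (component G a) a b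

  component-≈ : ∀ {a b} → E G a b → component G a ≈G component G b
  component-≈ {a} {b} e =
    (λ i → mk⇔ (λ (_ , p) → E-V b a (E-sym a b e) , (E-sym a b e ◅ p)) (λ (_ , p) → E-V a b e , (e ◅ p))) ,
    (λ i j → mk⇔ (λ (x , p) → x , (E-sym a b e ◅ p)) (λ (x , p) → x , (e ◅ p)))

  cut-sym : ∀ {a b} → E G a b → Cut a b → Cut b a
  cut-sym e (odd , _ , σ , σa , σb) =
    odd-≈ (component-≈ e) odd , (E-sym _ _ e , ε) , aut-≈ (component-≈ e) σ , σb , σa

  cut-forest : ∀ {H} → CutStep G H → Forest H
  cut-forest {H} (hv , he) = record
    { E-sym = λ i j x → let (e , ¬cut) = to (he i j) x in
                from (he j i) (E-sym i j e , ¬cut ∘ cut-sym (E-sym i j e))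
    ; E-irr = λ i x → E-irr i (proj₁ (to (he i i) x))
    ; E-V   = λ i j x → from (hv i) (E-V i j (proj₁ (to (he i j) x))) } ,
    acyclic-⊆ (λ i j x → proj₁ (to (he i j) x)) acyclic

  module _ (cut? : ∀ a b → Dec (Cut a b)) where

    cut-pair? : ∀ p → Dec (Cut (proj₁ p) (proj₂ p))
    cut-pair? p = cut? (proj₁ p) (proj₂ p)

    cuts : List (Fin n × Fin n)
    cuts = filter cut-pair? (allPairs n)

    cuts-mirrors : Mirrors cuts
    cuts-mirrors = All.map (mirror-of-bridge ∘ proj₂) (all-filter cut-pair? (allPairs n))

    cut-≈ : ∀ {H} → CutStep G H → (G ∖ cuts) ≈G H
    cut-≈ (hv , he) = (λ i → mk⇔ (from (hv i)) (to (hv i))) , λ i j → mk⇔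
      (λ (e , ∉cuts) → from (he i j) (e , λ c →
         ∉cuts (inj₁ (∈-filter⁺ cut-pair? (∈-cartesianProduct⁺ (∈-allFin i) (∈-allFin j)) c))))
      (λ x → let (e , ¬cut) = to (he i j) x in e , λ
         { (inj₁ m) → ¬cut (proj₂ (∈-filter⁻ cut-pair? {xs = allPairs n} m))
         ; (inj₂ m) → ¬cut (cut-sym (E-sym i j e) (proj₂ (∈-filter⁻ cut-pair? {xs = allPairs n} m))) })

  cut-parity : ∀ {F H} → WellFormed F → EvenGraph F → CutStep G H →
               ∀ {k k′} → SubCount F G k → SubCount F H k′ → ¬ ¬ (k % 2 ≡ k′ % 2)
  cut-parity {F} wfF evenF step ck ck′ = do
    side? ← ¬¬-Π-Fin n λ a → ¬¬-Π-Fin n λ b → ¬¬-Π-Fin n λ x → ¬¬-excluded-middle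
    cut?  ← ¬¬-Π-Fin n λ a → ¬¬-Π-Fin n λ b → ¬¬-excluded-middle
    RemoveBridge.parity-remove G wf acyclic F wfF evenF side? (cuts cut?) (cuts-mirrors cut?)
      ck (subCount-≈ (≈G-sym (cut-≈ cut? step)) ck′)

module _ {n : ℕ} {G F : Graph n} (forest : Forest G) (wfF : WellFormed F) (evenF : EvenGraph F)
  (seq : ℕ → Graph n) (seq₀ : seq 0 ≈G G) (cut : ∀ i → CutStep (seq i) (seq (suc i))) where

  seq-forest : ∀ i → Forest (seq i)
  seq-forest zero    = forest-≈ (≈G-sym seq₀) forest
  seq-forest (suc i) = CutStepParity.cut-forest (seq i) (seq-forest i) (cut i)

  seq-parity : ∀ i {k k′} → SubCount F G k → SubCount F (seq i) k′ → ¬ ¬ (k % 2 ≡ k′ % 2)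
  seq-parity zero    ck ck′ = return (cong (_% 2) (count-unique ck (subCount-≈ seq₀ ck′)))
  seq-parity (suc i) ck ck′ = do
    (j , cj) ← count-exists (candidates n)
    k≡j ← seq-parity i ck cj
    j≡k′ ← CutStepParity.cut-parity (seq i) (seq-forest i) wfF evenF (cut i) cj ck′
    return (trans k≡j j≡k′)

-- Lemma 6.6: for a forest G and an even graph F,
-- |Sub_F(G)| ≡ |Sub_F(G_rc)| (mod 2).  G_rc is reached after m cutting steps.

lemma6p6 : ∀ {n : ℕ} (G F Grc : Graph n) →
    Forest G → WellFormed F → EvenGraph F → F ⊆G G →
    RecCut G Grc →
    ∀ (k k′ : ℕ) → SubCount F G k → SubCount F Grc k′ →
    k % 2 ≡ k′ % 2
lemma6p6 G F Grc forest wfF evenF _ (seq , seq₀ , cut , m , stable) k k′ ck ck′ =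
  decidable-stable (k % 2 ≟ k′ % 2)
    (seq-parity forest wfF evenF seq seq₀ cut m ck (subCount-≈ (≈G-sym (stable m ≤-refl)) ck′))
  where open import Data.Nat using (_≟_)
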